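{- Let $m\ge 2$ and let $B\in\mathbf V_{2,m}$ be finite and projective in $\mathbf V_{2,m}$. Then $B$ is directly indecomposable, and $f(a_1)\cdot\ldots\cdot f(a_k)\neq 0$ for all non-closed atoms $a_1,\dots,a_k$ of $B$ whenever $k\le m$.
   Context: A closure algebra is a Boolean algebra with a map $f$ satisfying $f(0)=0$, $f(a+b)=f(a)+f(b)$, $a\le f(a)$, $f(f(a))\le f(a)$; $a$ is closed if $f(a)=a$. For a finite partial order $(P,\precsim)$, its complex algebra is $2^P$ with $f(X)=\{x:\exists y\in X,\ x\precsim y\}$. The height of $P$ is the maximal number of elements of a chain; the width of a subset is the maximal size of an antichain in it; the local width is $\max_{x\in P}$ width of ${\uparrow}x=\{y: x\precsim y\}$. $F_{2,m}$ is the class of finite partial orders of height at most $2$ and local width at most $m$, and $\mathbf V_{2,m}$ is the variety of closure algebras generated by their complex algebras. $B$ is projective in $\mathbf V_{2,m}$ if for every $A\in\mathbf V_{2,m}$ and surjective homomorphism $p\colon A\to B$ there is a homomorphism $q\colon B\to A$ with $p\circ q=\mathrm{id}_B$. Directly indecomposable means not isomorphic to a product of two nontrivial algebras. -}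

module Defs where

open import Data.Nat using (ℕ; _≤_)
open import Data.Fin using (Fin)
open import Data.Bool using (Bool)
open import Data.Vec using (tabulate)
open import Data.Product using (Σ; Σ-syntax; _×_; _,_)
open import Data.Sum using (_⊎_)
open import Data.Empty using (⊥)
open import Relation.Nullary using (¬_; Dec)
open import Relation.Nullary.Decidable using (⌊_⌋; _×-dec_)
open import Relation.Binary.PropositionalEquality using (_≡_; _≢_)
open import Function.Bundles using (_↔_)
import Data.Fin.Subset as S
open S using (Subset; _∈_)
open import Data.Fin.Subset.Properties using (_∈?_)
open import Data.Fin.Properties using (any?)

-- Algebras of the signature of closure algebras: (+, ·, -, 0, 1, f).
-- Carriers are types with propositional equality (set-theoretic reading).

record Alg : Set₁ where
  field
    Carrier : Set
    𝟘 𝟙     : Carrier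
    _⊕_ _⊙_ : Carrier → Carrier → Carrier
    ─_      : Carrier → Carrier
    cl      : Carrier → Carrier

data Term : Set where
  var       : ℕ → Term
  zeroT oneT : Term
  _+T_ _·T_ : Term → Term → Term
  negT clT  : Term → Term

module _ (A : Alg) where
  open Alg A

  ⟦_⟧ : Term → (ℕ → Carrier) → Carrier
  ⟦ var i ⟧ ρ = ρ i
  ⟦ zeroT ⟧ ρ = 𝟘
  ⟦ oneT ⟧ ρ = 𝟙
  ⟦ s +T t ⟧ ρ = ⟦ s ⟧ ρ ⊕ ⟦ t ⟧ ρ
  ⟦ s ·T t ⟧ ρ = ⟦ s ⟧ ρ ⊙ ⟦ t ⟧ ρ
  ⟦ negT s ⟧ ρ = ─ (⟦ s ⟧ ρ)
  ⟦ clT s ⟧ ρ = cl (⟦ s ⟧ ρ)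

  Satisfies : Term → Term → Set
  Satisfies s t = ∀ (ρ : ℕ → Carrier) → ⟦ s ⟧ ρ ≡ ⟦ t ⟧ ρ

  _≤A_ : Carrier → Carrier → Set
  a ≤A b = a ⊙ b ≡ a

  Closed : Carrier → Set
  Closed a = cl a ≡ a

  Atom : Carrier → Set
  Atom a = (a ≢ 𝟘) × (∀ b → b ≤A a → (b ≡ 𝟘) ⊎ (b ≡ a))

  prod : (k : ℕ) → (Fin k → Carrier) → Carrier
  prod ℕ.zero x = 𝟙
  prod (ℕ.suc k) x = x Fin.zero ⊙ prod k (λ i → x (Fin.suc i))

  Finite : Set
  Finite = Σ[ n ∈ ℕ ] (Carrier ↔ Fin n)

  Nontrivial : Set
  Nontrivial = Σ[ x ∈ Carrier ] Σ[ y ∈ Carrier ] x ≢ y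

record FinPoset : Set₁ where
  field
    size    : ℕ
    _≼_     : Fin size → Fin size → Set
    ≼?      : ∀ x y → Dec (x ≼ y)
    ≼-refl  : ∀ x → x ≼ x
    ≼-antisym : ∀ {x y} → x ≼ y → y ≼ x → x ≡ y
    ≼-trans : ∀ {x y z} → x ≼ y → y ≼ z → x ≼ z

module _ (P : FinPoset) where
  open FinPoset P

  IsChain : Subset size → Set
  IsChain C = ∀ x y → x ∈ C → y ∈ C → (x ≼ y) ⊎ (y ≼ x)

  IsAntichain : Subset size → Set
  IsAntichain C = ∀ x y → x ∈ C → y ∈ C → x ≼ y → x ≡ y

  HeightAtMost : ℕ → Set
  HeightAtMost h = ∀ (C : Subset size) → IsChain C → S.∣ C ∣ ≤ h

  LocalWidthAtMost : ℕ → Set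
  LocalWidthAtMost m = ∀ (x : Fin size) (C : Subset size) →
    (∀ y → y ∈ C → x ≼ y) → IsAntichain C → S.∣ C ∣ ≤ m

  -- complex algebra 2^P with f(X) = { x | ∃ y ∈ X, x ≼ y }
  Cm : Alg
  Cm = record
    { Carrier = Subset size
    ; 𝟘 = S.⊥
    ; 𝟙 = S.⊤
    ; _⊕_ = S._∪_
    ; _⊙_ = S._∩_
    ; ─_ = S.∁
    ; cl = λ X → tabulate (λ x → ⌊ any? (λ y → (y ∈? X) ×-dec ≼? x y) ⌋)
    }

InF2 : ℕ → FinPoset → Set
InF2 m P = HeightAtMost P 2 × LocalWidthAtMost P m

-- V_{2,m}: the variety generated by { Cm P | P ∈ F_{2,m} }, i.e. the class of
-- algebras satisfying every equation valid in all those complex algebras.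
InV : ℕ → Alg → Set₁
InV m A = ∀ (s t : Term) →
  (∀ (P : FinPoset) → InF2 m P → Satisfies (Cm P) s t) → Satisfies A s t

record Hom (A B : Alg) : Set where
  private module A = Alg A
  private module B = Alg B
  field
    map  : A.Carrier → B.Carrier
    pres-𝟘 : map A.𝟘 ≡ B.𝟘
    pres-𝟙 : map A.𝟙 ≡ B.𝟙
    pres-⊕ : ∀ x y → map (x A.⊕ y) ≡ map x B.⊕ map y
    pres-⊙ : ∀ x y → map (x A.⊙ y) ≡ map x B.⊙ map y
    pres-─ : ∀ x → map (A.─ x) ≡ B.─ (map x)
    pres-cl : ∀ x → map (A.cl x) ≡ B.cl (map x)
open Hom public

Surjective : ∀ {A B} → Hom A B → Set
Surjective {A} {B} p = ∀ (b : Alg.Carrier B) → Σ[ a ∈ Alg.Carrier A ] map p a ≡ b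

Isomorphic : Alg → Alg → Set
Isomorphic A B = Σ[ h ∈ Hom A B ] Σ[ g ∈ (Alg.Carrier B → Alg.Carrier A) ]
  ((∀ a → g (map h a) ≡ a) × (∀ b → map h (g b) ≡ b))

_⊗_ : Alg → Alg → Alg
C ⊗ D = record
  { Carrier = C.Carrier × D.Carrier
  ; 𝟘 = C.𝟘 , D.𝟘
  ; 𝟙 = C.𝟙 , D.𝟙
  ; _⊕_ = λ { (a , b) (c , d) → (a C.⊕ c) , (b D.⊕ d) }
  ; _⊙_ = λ { (a , b) (c , d) → (a C.⊙ c) , (b D.⊙ d) }
  ; ─_ = λ { (a , b) → (C.─ a) , (D.─ b) }
  ; cl = λ { (a , b) → C.cl a , D.cl b }
  }
  where
    module C = Alg C
    module D = Alg D

DirectlyIndecomposable : Alg → Set₁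
DirectlyIndecomposable B =
  ¬ (Σ[ C ∈ Alg ] Σ[ D ∈ Alg ] Nontrivial C × Nontrivial D × Isomorphic B (C ⊗ D))

Projective : ℕ → Alg → Set₁
Projective m B = ∀ (A : Alg) → InV m A → (p : Hom A B) → Surjective p →
  Σ[ q ∈ Hom B A ] (∀ b → map p (map q b) ≡ b)

module Submission where

-- Call an atom a of B maximal when a ⊑ cl b implies a ⊑ b (a maximal point of the dual poset).
-- Height ≤ 2 makes every non-closed atom maximal, and for a maximal atom a the map b ↦ [a ⊑ b] is a
-- homomorphism onto the two-element algebra with trivial closure. Given such homomorphisms φ₁ … φₖ
-- (k ≤ m), adjoin to B one new point lying below the points φ₁ … φₖ: the resulting algebra embeds into
-- B × Cm(fan with k leaves), so it lies in V_{2,m}, and it projects onto B. A section q of that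
-- projection sends cl bᵢ to an element containing the new point whenever φᵢ(bᵢ) holds, so
-- q(∏ cl bᵢ) ≠ 0 and hence ∏ cl bᵢ ≠ 0. If B ≅ C × D nontrivially then e = (1, 0) is a nonzero
-- clopen element with nonzero complement; maximal atoms below e and below −e have disjoint closures,
-- contradicting the case k = 2.

open import Defs
open import Data.Nat using (ℕ; zero; suc; _≤_; s≤s; z≤n)
open import Data.Nat.Properties using (≤-refl; ≤-trans; n≤1+n; ≤⇒≯)
open import Data.Nat.Induction using (<-wellFounded)
open import Induction.WellFounded using (WellFounded; Acc; acc; module Subrelation)
import Relation.Binary.Construct.On as On
open import Data.Fin using (Fin) renaming (zero to fz; suc to fs)
open import Data.Fin.Properties using (any?) renaming (_≟_ to _≟ᶠ_)
open import Data.Bool using (Bool; true; false; _∧_; _∨_; not; T)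
open import Data.Bool.Properties using (T-∧; T-≡) renaming (_≟_ to _≟𝔹_)
open import Data.Unit using (tt)
open import Data.Empty using (⊥; ⊥-elim)
open import Data.Product using (Σ; ∃; _×_; _,_; proj₁; proj₂)
open import Data.Sum using (_⊎_; inj₁; inj₂)
open import Data.Vec using (Vec; _∷_; head; lookup; tabulate; replicate; zipWith; here; there)
open import Data.Vec.Properties
  using (tabulate-∘; tabulate-cong; tabulate∘lookup; lookup∘tabulate; lookup-zipWith; lookup-map;
         lookup-replicate; []=⇒lookup; lookup⇒[]=)
open import Function using (_∘_; _⇔_; Equivalence; mk⇔; Inverse)
open import Relation.Nullary using (¬_; Dec; yes; no; does; ¬?)
open import Relation.Nullary.Decidable
  using (⌊_⌋; toWitness; fromWitness; _×-dec_; _⊎-dec_; map′; dec-true; dec-false; does-⇔;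
         decidable-stable)
open import Relation.Binary.PropositionalEquality
open ≡-Reasoning
import Data.Fin.Subset as S
open S using (Subset; inside; outside; _∈_; _∪_; ⁅_⁆; ∣_∣)
open import Data.Fin.Subset.Properties
  using (_∈?_; ⊆-antisym; x∈p∪q⁻; x∈p∪q⁺; x∈p∩q⁻; x∈p∩q⁺; x∈∁p⇒x∉p; ∉⊥; x∈⁅x⁆; x∈⁅y⁆⇒x≡y;
         x∈p⇒∣p-x∣<∣p∣; x∈p∧x≢y⇒x∈p-y; p⊂q⇒∣p∣<∣q∣; p⊆q⇒∣p∣≤∣q∣; ∣⁅x⁆∣≡1; ∣⊥∣≡0; ∣p∣≤n;
         Empty-unique; nonempty?)

vecExt : ∀ {A : Set} {n} {u v : Vec A n} → (∀ i → lookup u i ≡ lookup v i) → u ≡ v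
vecExt {u = u} {v} u≗v = trans (sym (tabulate∘lookup u)) (trans (tabulate-cong u≗v) (tabulate∘lookup v))

tabulate-zipWith : ∀ {X Y Z : Set} {n} (f : X → Y → Z) (g : Fin n → X) (h : Fin n → Y) →
  tabulate (λ i → f (g i) (h i)) ≡ zipWith f (tabulate g) (tabulate h)
tabulate-zipWith {n = zero}  f g h = refl
tabulate-zipWith {n = suc n} f g h = cong (f (g fz) (h fz) ∷_) (tabulate-zipWith f (g ∘ fs) (h ∘ fs))

tabulate-const : ∀ {X : Set} {n} (x : X) → tabulate {n = n} (λ _ → x) ≡ replicate n x
tabulate-const {n = zero}  x = refl
tabulate-const {n = suc n} x = cong (x ∷_) (tabulate-const x)

∣x∷p∣≤1+∣p∣ : ∀ {n} x (p : Subset n) → ∣ x ∷ p ∣ ≤ suc ∣ p ∣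
∣x∷p∣≤1+∣p∣ inside  p = ≤-refl
∣x∷p∣≤1+∣p∣ outside p = n≤1+n ∣ p ∣

∣p∣≤1 : ∀ {n} {p : Subset n} → (∀ {x y} → x ∈ p → y ∈ p → x ≡ y) → ∣ p ∣ ≤ 1
∣p∣≤1 {n} {p} all-equal with nonempty? p
... | yes (x , x∈p) = subst (∣ p ∣ ≤_) (∣⁅x⁆∣≡1 x)
  (p⊆q⇒∣p∣≤∣q∣ λ y∈p → subst (_∈ ⁅ x ⁆) (all-equal x∈p y∈p) (x∈⁅x⁆ x))
... | no empty = subst (_≤ 1) (sym (trans (cong ∣_∣ (Empty-unique empty)) (∣⊥∣≡0 n))) z≤n

does≡true⇒ : ∀ {p} {Q : Set p} (q? : Dec Q) → does q? ≡ true → Q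
does≡true⇒ (yes q) _ = q

-- Equations under homomorphisms

module _ {A : Alg} where
  private module A = Alg A

  ⟦⟧-cong : (t : Term) {ρ σ : ℕ → A.Carrier} → (∀ i → ρ i ≡ σ i) → ⟦_⟧ A t ρ ≡ ⟦_⟧ A t σ
  ⟦⟧-cong (var i)  ρ≗σ = ρ≗σ i
  ⟦⟧-cong zeroT    ρ≗σ = refl
  ⟦⟧-cong oneT     ρ≗σ = refl
  ⟦⟧-cong (s +T t) ρ≗σ = cong₂ A._⊕_ (⟦⟧-cong s ρ≗σ) (⟦⟧-cong t ρ≗σ)
  ⟦⟧-cong (s ·T t) ρ≗σ = cong₂ A._⊙_ (⟦⟧-cong s ρ≗σ) (⟦⟧-cong t ρ≗σ)
  ⟦⟧-cong (negT s) ρ≗σ = cong A.─_ (⟦⟧-cong s ρ≗σ)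
  ⟦⟧-cong (clT s)  ρ≗σ = cong A.cl (⟦⟧-cong s ρ≗σ)

module _ {A A′ : Alg} where
  private
    module A = Alg A
    module A′ = Alg A′

  ⟦⟧-hom : (h : Hom A A′) (t : Term) (ρ : ℕ → A.Carrier) → map h (⟦_⟧ A t ρ) ≡ ⟦_⟧ A′ t (map h ∘ ρ)
  ⟦⟧-hom h (var i)  ρ = refl
  ⟦⟧-hom h zeroT    ρ = pres-𝟘 h
  ⟦⟧-hom h oneT     ρ = pres-𝟙 h
  ⟦⟧-hom h (s +T t) ρ = trans (pres-⊕ h _ _) (cong₂ A′._⊕_ (⟦⟧-hom h s ρ) (⟦⟧-hom h t ρ))
  ⟦⟧-hom h (s ·T t) ρ = trans (pres-⊙ h _ _) (cong₂ A′._⊙_ (⟦⟧-hom h s ρ) (⟦⟧-hom h t ρ))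
  ⟦⟧-hom h (negT s) ρ = trans (pres-─ h _) (cong A′.─_ (⟦⟧-hom h s ρ))
  ⟦⟧-hom h (clT s)  ρ = trans (pres-cl h _) (cong A′.cl (⟦⟧-hom h s ρ))

  Satisfies-image : (h : Hom A A′) → Surjective h → ∀ s t → Satisfies A s t → Satisfies A′ s t
  Satisfies-image h surj s t A⊨s≈t ρ = begin
    ⟦_⟧ A′ s ρ                ≡⟨ ⟦⟧-cong s ρ≗hσ ⟩
    ⟦_⟧ A′ s (map h ∘ σ)      ≡⟨ ⟦⟧-hom h s σ ⟨
    map h (⟦_⟧ A s σ)         ≡⟨ cong (map h) (A⊨s≈t σ) ⟩
    map h (⟦_⟧ A t σ)         ≡⟨ ⟦⟧-hom h t σ ⟩
    ⟦_⟧ A′ t (map h ∘ σ)      ≡⟨ ⟦⟧-cong t ρ≗hσ ⟨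
    ⟦_⟧ A′ t ρ                ∎
    where
    σ : ℕ → A.Carrier
    σ i = proj₁ (surj (ρ i))
    ρ≗hσ : ∀ i → ρ i ≡ map h (σ i)
    ρ≗hσ i = sym (proj₂ (surj (ρ i)))

Satisfies-jointEmbedding : ∀ {A A₁ A₂ : Alg} (h₁ : Hom A A₁) (h₂ : Hom A A₂) →
  (∀ {x y} → map h₁ x ≡ map h₁ y → map h₂ x ≡ map h₂ y → x ≡ y) →
  ∀ s t → Satisfies A₁ s t → Satisfies A₂ s t → Satisfies A s t
Satisfies-jointEmbedding {A} h₁ h₂ jointly-injective s t A₁⊨ A₂⊨ ρ =
  jointly-injective (via h₁ A₁⊨) (via h₂ A₂⊨)
  where
  via : ∀ {A′} (h : Hom A A′) → Satisfies A′ s t → map h (⟦_⟧ _ s ρ) ≡ map h (⟦_⟧ _ t ρ)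
  via h A′⊨ = trans (⟦⟧-hom h s ρ) (trans (A′⊨ (map h ∘ ρ)) (sym (⟦⟧-hom h t ρ)))

map-prod : ∀ {A A′} (h : Hom A A′) k (xs : Fin k → Alg.Carrier A) →
  map h (prod A k xs) ≡ prod A′ k (map h ∘ xs)
map-prod h zero    xs = pres-𝟙 h
map-prod {A′ = A′} h (suc k) xs =
  trans (pres-⊙ h _ _) (cong (Alg._⊙_ A′ (map h (xs fz))) (map-prod h k (xs ∘ fs)))

module _ {m : ℕ} where
  InV-image : ∀ {A A′} → InV m A → (h : Hom A A′) → Surjective h → InV m A′
  InV-image A∈V h surj s t valid = Satisfies-image h surj s t (A∈V s t valid)

  InV-jointEmbedding : ∀ {A A₁ A₂} → InV m A₁ → InV m A₂ → (h₁ : Hom A A₁) (h₂ : Hom A A₂) →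
    (∀ {x y} → map h₁ x ≡ map h₁ y → map h₂ x ≡ map h₂ y → x ≡ y) → InV m A
  InV-jointEmbedding A₁∈V A₂∈V h₁ h₂ inj s t valid =
    Satisfies-jointEmbedding h₁ h₂ inj s t (A₁∈V s t valid) (A₂∈V s t valid)

  InV-Cm : ∀ {P} → InF2 m P → InV m (Cm P)
  InV-Cm {P} P∈F s t valid = valid P P∈F

-- Boolean laws

𝟚 : Alg
𝟚 = record
  { Carrier = Bool ; 𝟘 = false ; 𝟙 = true ; _⊕_ = _∨_ ; _⊙_ = _∧_ ; ─_ = not ; cl = λ x → x }

x̂ ŷ ẑ : Term
x̂ = var 0
ŷ = var 1
ẑ = var 2

clFree₃ : Term → Bool
clFree₃ (var 0)  = true
clFree₃ (var 1)  = true
clFree₃ (var 2)  = true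
clFree₃ (var _)  = false
clFree₃ zeroT    = true
clFree₃ oneT     = true
clFree₃ (s +T t) = clFree₃ s ∧ clFree₃ t
clFree₃ (s ·T t) = clFree₃ s ∧ clFree₃ t
clFree₃ (negT s) = clFree₃ s
clFree₃ (clT s)  = false

env₃ : {X : Set} → X → X → X → ℕ → X
env₃ x y z 0 = x
env₃ x y z 1 = y
env₃ x y z _ = z

∀𝔹 : (Bool → Bool) → Bool
∀𝔹 f = f false ∧ f true

∀𝔹-sound : ∀ f → T (∀𝔹 f) → ∀ x → T (f x)
∀𝔹-sound f holds false = proj₁ (Equivalence.to (T-∧ {f false}) holds)
∀𝔹-sound f holds true  = proj₂ (Equivalence.to (T-∧ {f false}) holds)

∀𝔹³ : (Bool → Bool → Bool → Bool) → Bool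
∀𝔹³ f = ∀𝔹 λ x → ∀𝔹 λ y → ∀𝔹 λ z → f x y z

∀𝔹³-sound : ∀ f → T (∀𝔹³ f) → ∀ x y z → T (f x y z)
∀𝔹³-sound f holds x y z =
  ∀𝔹-sound (f x y) (∀𝔹-sound (λ y → ∀𝔹 (f x y)) (∀𝔹-sound (λ x → ∀𝔹 λ y → ∀𝔹 (f x y)) holds x) y) z

agreeOn𝟚 : Term → Term → Bool → Bool → Bool → Bool
agreeOn𝟚 s t x y z = ⌊ ⟦_⟧ 𝟚 s (env₃ x y z) ≟𝔹 ⟦_⟧ 𝟚 t (env₃ x y z) ⌋

-- Decided by truth tables; such equations hold pointwise in every Cm P, hence in all of V_{2,m}.
isBooleanLaw : Term → Term → Bool
isBooleanLaw s t = clFree₃ s ∧ clFree₃ t ∧ ∀𝔹³ (agreeOn𝟚 s t)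

⟦⟧-env₃ : (A : Alg) (t : Term) (ρ : ℕ → Alg.Carrier A) → T (clFree₃ t) →
  ⟦_⟧ A t ρ ≡ ⟦_⟧ A t (env₃ (ρ 0) (ρ 1) (ρ 2))
⟦⟧-env₃ A (var 0)  ρ _ = refl
⟦⟧-env₃ A (var 1)  ρ _ = refl
⟦⟧-env₃ A (var 2)  ρ _ = refl
⟦⟧-env₃ A zeroT    ρ _ = refl
⟦⟧-env₃ A oneT     ρ _ = refl
⟦⟧-env₃ A (s +T t) ρ c = let cs , ct = Equivalence.to (T-∧ {clFree₃ s}) c in
  cong₂ (Alg._⊕_ A) (⟦⟧-env₃ A s ρ cs) (⟦⟧-env₃ A t ρ ct)
⟦⟧-env₃ A (s ·T t) ρ c = let cs , ct = Equivalence.to (T-∧ {clFree₃ s}) c in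
  cong₂ (Alg._⊙_ A) (⟦⟧-env₃ A s ρ cs) (⟦⟧-env₃ A t ρ ct)
⟦⟧-env₃ A (negT s) ρ c = cong (Alg.─_ A) (⟦⟧-env₃ A s ρ c)

module _ (s t : Term) (law : T (isBooleanLaw s t)) where
  private
    conjuncts : T (clFree₃ s) × T (clFree₃ t) × T (∀𝔹³ (agreeOn𝟚 s t))
    conjuncts = let cs , rest = Equivalence.to (T-∧ {clFree₃ s}) law in
      cs , Equivalence.to (T-∧ {clFree₃ t}) rest

  isBooleanLaw⇒clFree₃ˡ : T (clFree₃ s)
  isBooleanLaw⇒clFree₃ˡ = proj₁ conjuncts

  isBooleanLaw⇒clFree₃ʳ : T (clFree₃ t)
  isBooleanLaw⇒clFree₃ʳ = proj₁ (proj₂ conjuncts)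

  isBooleanLaw⇒𝟚 : Satisfies 𝟚 s t
  isBooleanLaw⇒𝟚 ρ = begin
    ⟦_⟧ 𝟚 s ρ                             ≡⟨ ⟦⟧-env₃ 𝟚 s ρ isBooleanLaw⇒clFree₃ˡ ⟩
    ⟦_⟧ 𝟚 s (env₃ (ρ 0) (ρ 1) (ρ 2))      ≡⟨ toWitness (agree (ρ 0) (ρ 1) (ρ 2)) ⟩
    ⟦_⟧ 𝟚 t (env₃ (ρ 0) (ρ 1) (ρ 2))      ≡⟨ ⟦⟧-env₃ 𝟚 t ρ isBooleanLaw⇒clFree₃ʳ ⟨
    ⟦_⟧ 𝟚 t ρ                             ∎
    where
    agree : ∀ x y z → T (agreeOn𝟚 s t x y z)
    agree = ∀𝔹³-sound (agreeOn𝟚 s t) (proj₂ (proj₂ conjuncts))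

-- Complex algebras

module ComplexAlgebra (P : FinPoset) where
  open FinPoset P
  open Alg (Cm P)

  lookup-⟦⟧ : (t : Term) (ρ : ℕ → Subset size) (x : Fin size) → T (clFree₃ t) →
    lookup (⟦_⟧ (Cm P) t ρ) x ≡ ⟦_⟧ 𝟚 t (λ i → lookup (ρ i) x)
  lookup-⟦⟧ (var i)  ρ x _ = refl
  lookup-⟦⟧ zeroT    ρ x _ = lookup-replicate x false
  lookup-⟦⟧ oneT     ρ x _ = lookup-replicate x true
  lookup-⟦⟧ (s +T t) ρ x c = let cs , ct = Equivalence.to (T-∧ {clFree₃ s}) c in
    trans (lookup-zipWith _∨_ x (⟦_⟧ (Cm P) s ρ) (⟦_⟧ (Cm P) t ρ))
          (cong₂ _∨_ (lookup-⟦⟧ s ρ x cs) (lookup-⟦⟧ t ρ x ct))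
  lookup-⟦⟧ (s ·T t) ρ x c = let cs , ct = Equivalence.to (T-∧ {clFree₃ s}) c in
    trans (lookup-zipWith _∧_ x (⟦_⟧ (Cm P) s ρ) (⟦_⟧ (Cm P) t ρ))
          (cong₂ _∧_ (lookup-⟦⟧ s ρ x cs) (lookup-⟦⟧ t ρ x ct))
  lookup-⟦⟧ (negT s) ρ x c = trans (lookup-map x not (⟦_⟧ (Cm P) s ρ)) (cong not (lookup-⟦⟧ s ρ x c))

  isBooleanLaw⇒Cm : ∀ s t → T (isBooleanLaw s t) → Satisfies (Cm P) s t
  isBooleanLaw⇒Cm s t law ρ = vecExt λ x → begin
    lookup (⟦_⟧ (Cm P) s ρ) x           ≡⟨ lookup-⟦⟧ s ρ x (isBooleanLaw⇒clFree₃ˡ s t law) ⟩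
    ⟦_⟧ 𝟚 s (λ i → lookup (ρ i) x)      ≡⟨ isBooleanLaw⇒𝟚 s t law _ ⟩
    ⟦_⟧ 𝟚 t (λ i → lookup (ρ i) x)      ≡⟨ lookup-⟦⟧ t ρ x (isBooleanLaw⇒clFree₃ʳ s t law) ⟨
    lookup (⟦_⟧ (Cm P) t ρ) x           ∎

  lookup-cl : ∀ X x → lookup (cl X) x ≡ ⌊ any? (λ y → (y ∈? X) ×-dec ≼? x y) ⌋
  lookup-cl X x = lookup∘tabulate _ x

  ∈-cl⁻ : ∀ {X x} → x ∈ cl X → ∃ λ y → y ∈ X × x ≼ y
  ∈-cl⁻ {X} {x} x∈clX =
    toWitness (Equivalence.from T-≡ (trans (sym (lookup-cl X x)) ([]=⇒lookup x∈clX)))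

  ∈-cl⁺ : ∀ {X x y} → y ∈ X → x ≼ y → x ∈ cl X
  ∈-cl⁺ {X} {x} {y} y∈X x≼y =
    lookup⇒[]= x (cl X) (trans (lookup-cl X x) (Equivalence.to T-≡ (fromWitness (y , y∈X , x≼y))))

  lookup-cl-maximal : ∀ X {x} → (∀ {y} → x ≼ y → y ≡ x) → lookup (cl X) x ≡ lookup X x
  lookup-cl-maximal X {x} maximal with lookup (cl X) x in x∈?clX | lookup X x in x∈?X
  ... | false | false = refl
  ... | true  | true  = refl
  ... | true  | false with ∈-cl⁻ (lookup⇒[]= x (cl X) x∈?clX)
  ...   | y , y∈X , x≼y with () ← trans (sym x∈?X) ([]=⇒lookup (subst (_∈ X) (maximal x≼y) y∈X))
  lookup-cl-maximal X {x} maximal | false | true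
    with () ← trans (sym x∈?clX) ([]=⇒lookup (∈-cl⁺ (lookup⇒[]= x X x∈?X) (≼-refl x)))

  cl-𝟘 : Satisfies (Cm P) (clT zeroT) zeroT
  cl-𝟘 _ = ⊆-antisym (λ x∈ → let _ , y∈⊥ , _ = ∈-cl⁻ x∈ in ⊥-elim (∉⊥ y∈⊥)) (λ x∈⊥ → ⊥-elim (∉⊥ x∈⊥))

  cl-⊕ : Satisfies (Cm P) (clT (x̂ +T ŷ)) (clT x̂ +T clT ŷ)
  cl-⊕ ρ = ⊆-antisym ⊆ ⊇
    where
    X Y : Subset size
    X = ρ 0
    Y = ρ 1
    ⊆ : cl (X ⊕ Y) S.⊆ cl X ⊕ cl Y
    ⊆ x∈ with ∈-cl⁻ x∈
    ... | y , y∈X∪Y , x≼y with x∈p∪q⁻ X Y y∈X∪Y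
    ... | inj₁ y∈X = x∈p∪q⁺ (inj₁ (∈-cl⁺ y∈X x≼y))
    ... | inj₂ y∈Y = x∈p∪q⁺ (inj₂ (∈-cl⁺ y∈Y x≼y))
    ⊇ : cl X ⊕ cl Y S.⊆ cl (X ⊕ Y)
    ⊇ x∈ with x∈p∪q⁻ (cl X) (cl Y) x∈
    ... | inj₁ x∈clX = let y , y∈X , x≼y = ∈-cl⁻ x∈clX in ∈-cl⁺ (x∈p∪q⁺ (inj₁ y∈X)) x≼y
    ... | inj₂ x∈clY = let y , y∈Y , x≼y = ∈-cl⁻ x∈clY in ∈-cl⁺ (x∈p∪q⁺ (inj₂ y∈Y)) x≼y

  cl-extensive : Satisfies (Cm P) (x̂ ·T clT x̂) x̂
  cl-extensive ρ = ⊆-antisym (λ x∈ → proj₁ (x∈p∩q⁻ X (cl X) x∈))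
                             (λ {x} x∈X → x∈p∩q⁺ (x∈X , ∈-cl⁺ x∈X (≼-refl x)))
    where
    X : Subset size
    X = ρ 0

  height≤2⇒no-3-chain : HeightAtMost P 2 → ∀ {x y z} → x ≼ y → y ≼ z → x ≢ y → y ≢ z → ⊥
  height≤2⇒no-3-chain height {x} {y} {z} x≼y y≼z x≢y y≢z = ≤⇒≯ (height C C-chain) 3≤∣C∣
    where
    C : Subset size
    C = ⁅ x ⁆ ∪ (⁅ y ⁆ ∪ ⁅ z ⁆)

    x∈C : x ∈ C
    x∈C = x∈p∪q⁺ (inj₁ (x∈⁅x⁆ x))
    y∈C : y ∈ C
    y∈C = x∈p∪q⁺ (inj₂ (x∈p∪q⁺ (inj₁ (x∈⁅x⁆ y))))
    z∈C : z ∈ C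
    z∈C = x∈p∪q⁺ (inj₂ (x∈p∪q⁺ (inj₂ (x∈⁅x⁆ z))))

    ∈C⁻ : ∀ {u} → u ∈ C → u ≡ x ⊎ u ≡ y ⊎ u ≡ z
    ∈C⁻ u∈C with x∈p∪q⁻ ⁅ x ⁆ _ u∈C
    ... | inj₁ u∈x = inj₁ (x∈⁅y⁆⇒x≡y x u∈x)
    ... | inj₂ u∈yz with x∈p∪q⁻ ⁅ y ⁆ ⁅ z ⁆ u∈yz
    ... | inj₁ u∈y = inj₂ (inj₁ (x∈⁅y⁆⇒x≡y y u∈y))
    ... | inj₂ u∈z = inj₂ (inj₂ (x∈⁅y⁆⇒x≡y z u∈z))

    comparable : ∀ {u v} → u ≡ x ⊎ u ≡ y ⊎ u ≡ z → v ≡ x ⊎ v ≡ y ⊎ v ≡ z → (u ≼ v) ⊎ (v ≼ u)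
    comparable {u} (inj₁ refl)        (inj₁ refl)        = inj₁ (≼-refl u)
    comparable     (inj₁ refl)        (inj₂ (inj₁ refl)) = inj₁ x≼y
    comparable     (inj₁ refl)        (inj₂ (inj₂ refl)) = inj₁ (≼-trans x≼y y≼z)
    comparable     (inj₂ (inj₁ refl)) (inj₁ refl)        = inj₂ x≼y
    comparable {u} (inj₂ (inj₁ refl)) (inj₂ (inj₁ refl)) = inj₁ (≼-refl u)
    comparable     (inj₂ (inj₁ refl)) (inj₂ (inj₂ refl)) = inj₁ y≼z
    comparable     (inj₂ (inj₂ refl)) (inj₁ refl)        = inj₂ (≼-trans x≼y y≼z)
    comparable     (inj₂ (inj₂ refl)) (inj₂ (inj₁ refl)) = inj₂ y≼z
    comparable {u} (inj₂ (inj₂ refl)) (inj₂ (inj₂ refl)) = inj₁ (≼-refl u)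

    C-chain : IsChain P C
    C-chain u v u∈C v∈C = comparable (∈C⁻ u∈C) (∈C⁻ v∈C)

    z≢x : z ≢ x
    z≢x refl = x≢y (≼-antisym x≼y y≼z)

    -- removing x, then y, then z from C each time strictly decreases its size
    3≤∣C∣ : 3 ≤ ∣ C ∣
    3≤∣C∣ =
      ≤-trans (s≤s (≤-trans (s≤s (≤-trans (s≤s z≤n)
        (x∈p⇒∣p-x∣<∣p∣ (x∈p∧x≢y⇒x∈p-y (x∈p∧x≢y⇒x∈p-y z∈C z≢x) (y≢z ∘ sym)))))
        (x∈p⇒∣p-x∣<∣p∣ (x∈p∧x≢y⇒x∈p-y y∈C (x≢y ∘ sym)))))
        (x∈p⇒∣p-x∣<∣p∣ x∈C)

  cl-height≤2 : HeightAtMost P 2 → Satisfies (Cm P) (clT ((x̂ ·T clT ŷ) ·T negT ŷ) ·T negT x̂) zeroT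
  cl-height≤2 height ρ = ⊆-antisym impossible (λ x∈⊥ → ⊥-elim (∉⊥ x∈⊥))
    where
    X Y : Subset size
    X = ρ 0
    Y = ρ 1
    impossible : cl ((X ⊙ cl Y) ⊙ (─ Y)) ⊙ (─ X) S.⊆ 𝟘
    impossible x∈ with x∈p∩q⁻ _ (─ X) x∈
    ... | x∈clW , x∈∁X with ∈-cl⁻ x∈clW
    ... | w , w∈W , x≼w with x∈p∩q⁻ _ (─ Y) w∈W
    ... | w∈X∩clY , w∈∁Y with x∈p∩q⁻ X (cl Y) w∈X∩clY
    ... | w∈X , w∈clY with ∈-cl⁻ w∈clY
    ... | y , y∈Y , w≼y = ⊥-elim (height≤2⇒no-3-chain height x≼w w≼y
      (λ { refl → x∈∁p⇒x∉p x∈∁X w∈X }) (λ { refl → x∈∁p⇒x∉p w∈∁Y y∈Y }))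

module InVariety {m : ℕ} (A : Alg) (A∈V : InV m A) where
  open Alg A public

  booleanLaw : ∀ s t → T (isBooleanLaw s t) → ∀ x y z → ⟦_⟧ A s (env₃ x y z) ≡ ⟦_⟧ A t (env₃ x y z)
  booleanLaw s t isLaw x y z = A∈V s t (λ P _ → ComplexAlgebra.isBooleanLaw⇒Cm P s t isLaw) (env₃ x y z)

  ⊙-comm : ∀ x y → x ⊙ y ≡ y ⊙ x
  ⊙-comm x y = booleanLaw (x̂ ·T ŷ) (ŷ ·T x̂) tt x y x
  ⊙-assoc : ∀ x y z → (x ⊙ y) ⊙ z ≡ x ⊙ (y ⊙ z)
  ⊙-assoc = booleanLaw ((x̂ ·T ŷ) ·T ẑ) (x̂ ·T (ŷ ·T ẑ)) tt
  ⊙-idem : ∀ x → x ⊙ x ≡ x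
  ⊙-idem x = booleanLaw (x̂ ·T x̂) x̂ tt x x x
  ⊙-identityˡ : ∀ x → 𝟙 ⊙ x ≡ x
  ⊙-identityˡ x = booleanLaw (oneT ·T x̂) x̂ tt x x x
  ⊙-identityʳ : ∀ x → x ⊙ 𝟙 ≡ x
  ⊙-identityʳ x = booleanLaw (x̂ ·T oneT) x̂ tt x x x
  ⊙-zeroʳ : ∀ x → x ⊙ 𝟘 ≡ 𝟘
  ⊙-zeroʳ x = booleanLaw (x̂ ·T zeroT) zeroT tt x x x
  ⊕-identityˡ : ∀ x → 𝟘 ⊕ x ≡ x
  ⊕-identityˡ x = booleanLaw (zeroT +T x̂) x̂ tt x x x
  ⊕-identityʳ : ∀ x → x ⊕ 𝟘 ≡ x
  ⊕-identityʳ x = booleanLaw (x̂ +T zeroT) x̂ tt x x x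
  ⊙-distribˡ-⊕ : ∀ x y z → x ⊙ (y ⊕ z) ≡ (x ⊙ y) ⊕ (x ⊙ z)
  ⊙-distribˡ-⊕ = booleanLaw (x̂ ·T (ŷ +T ẑ)) ((x̂ ·T ŷ) +T (x̂ ·T ẑ)) tt
  ⊙-split : ∀ x y → (x ⊙ y) ⊕ (x ⊙ (─ y)) ≡ x
  ⊙-split x y = booleanLaw ((x̂ ·T ŷ) +T (x̂ ·T negT ŷ)) x̂ tt x y x
  ⊙-inverseʳ : ∀ x y → (x ⊙ y) ⊙ (─ y) ≡ 𝟘
  ⊙-inverseʳ x y = booleanLaw ((x̂ ·T ŷ) ·T negT ŷ) zeroT tt x y x
  ─-involutive : ∀ x → ─ (─ x) ≡ x
  ─-involutive x = booleanLaw (negT (negT x̂)) x̂ tt x x x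
  ─𝟙 : ─ 𝟙 ≡ 𝟘
  ─𝟙 = booleanLaw (negT oneT) zeroT tt 𝟘 𝟘 𝟘
  ─𝟘 : ─ 𝟘 ≡ 𝟙
  ─𝟘 = booleanLaw (negT zeroT) oneT tt 𝟘 𝟘 𝟘

  infix 4 _⊑_
  _⊑_ : Carrier → Carrier → Set
  _⊑_ = _≤A_ A

  ⊑-refl : ∀ {x} → x ⊑ x
  ⊑-refl = ⊙-idem _

  ⊑-trans : ∀ {x y z} → x ⊑ y → y ⊑ z → x ⊑ z
  ⊑-trans {x} {y} {z} x⊑y y⊑z = begin
    x ⊙ z        ≡⟨ cong (_⊙ z) x⊑y ⟨
    (x ⊙ y) ⊙ z  ≡⟨ ⊙-assoc x y z ⟩
    x ⊙ (y ⊙ z)  ≡⟨ cong (x ⊙_) y⊑z ⟩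
    x ⊙ y        ≡⟨ x⊑y ⟩
    x            ∎

  ⊑-antisym : ∀ {x y} → x ⊑ y → y ⊑ x → x ≡ y
  ⊑-antisym {x} {y} x⊑y y⊑x = trans (sym x⊑y) (trans (⊙-comm x y) y⊑x)

  ⊑-⊙ : ∀ {x y z} → x ⊑ y → x ⊑ z → x ⊑ y ⊙ z
  ⊑-⊙ {x} {y} {z} x⊑y x⊑z = trans (sym (⊙-assoc x y z)) (trans (cong (_⊙ z) x⊑y) x⊑z)

  x⊙y⊑x : ∀ x y → x ⊙ y ⊑ x
  x⊙y⊑x x y = booleanLaw ((x̂ ·T ŷ) ·T x̂) (x̂ ·T ŷ) tt x y x

  x⊙y⊑y : ∀ x y → x ⊙ y ⊑ y
  x⊙y⊑y x y = booleanLaw ((x̂ ·T ŷ) ·T ŷ) (x̂ ·T ŷ) tt x y x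

  x⊑x⊕y : ∀ x y → x ⊑ x ⊕ y
  x⊑x⊕y x y = booleanLaw (x̂ ·T (x̂ +T ŷ)) x̂ tt x y x

  y⊑x⊕y : ∀ x y → y ⊑ x ⊕ y
  y⊑x⊕y x y = booleanLaw (ŷ ·T (x̂ +T ŷ)) ŷ tt x y x

  x⊑𝟙 : ∀ x → x ⊑ 𝟙
  x⊑𝟙 = ⊙-identityʳ

  x⊑𝟘⇒x≡𝟘 : ∀ {x} → x ⊑ 𝟘 → x ≡ 𝟘
  x⊑𝟘⇒x≡𝟘 {x} x⊑𝟘 = trans (sym x⊑𝟘) (⊙-zeroʳ x)

  x⊑y∧x⊑─y⇒x≡𝟘 : ∀ {x y} → x ⊑ y → x ⊑ ─ y → x ≡ 𝟘
  x⊑y∧x⊑─y⇒x≡𝟘 {x} {y} x⊑y x⊑─y = trans (sym x⊑─y) (trans (cong (_⊙ ─ y) (sym x⊑y)) (⊙-inverseʳ x y))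

  x⊙─y≡𝟘⇒x⊑y : ∀ {x y} → x ⊙ (─ y) ≡ 𝟘 → x ⊑ y
  x⊙─y≡𝟘⇒x⊑y {x} {y} x⊙─y≡𝟘 = begin
    x ⊙ y                  ≡⟨ ⊕-identityʳ (x ⊙ y) ⟨
    (x ⊙ y) ⊕ 𝟘            ≡⟨ cong ((x ⊙ y) ⊕_) x⊙─y≡𝟘 ⟨
    (x ⊙ y) ⊕ (x ⊙ (─ y))  ≡⟨ ⊙-split x y ⟩
    x                      ∎

  x⊙y≡𝟘⇒x⊑─y : ∀ {x y} → x ⊙ y ≡ 𝟘 → x ⊑ ─ y
  x⊙y≡𝟘⇒x⊑─y {x} {y} x⊙y≡𝟘 = x⊙─y≡𝟘⇒x⊑y (trans (cong (x ⊙_) (─-involutive y)) x⊙y≡𝟘)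

  x⊑z∧y⊑─z⇒x⊙y≡𝟘 : ∀ {x y z} → x ⊑ z → y ⊑ ─ z → x ⊙ y ≡ 𝟘
  x⊑z∧y⊑─z⇒x⊙y≡𝟘 {x} {y} x⊑z y⊑─z = x⊑y∧x⊑─y⇒x≡𝟘 (⊑-trans (x⊙y⊑x x y) x⊑z) (⊑-trans (x⊙y⊑y x y) y⊑─z)

  cl-𝟘 : cl 𝟘 ≡ 𝟘
  cl-𝟘 = A∈V (clT zeroT) zeroT (λ P _ → ComplexAlgebra.cl-𝟘 P) (env₃ 𝟘 𝟘 𝟘)

  cl-⊕ : ∀ x y → cl (x ⊕ y) ≡ cl x ⊕ cl y
  cl-⊕ x y = A∈V (clT (x̂ +T ŷ)) (clT x̂ +T clT ŷ) (λ P _ → ComplexAlgebra.cl-⊕ P) (env₃ x y x)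

  x⊑cl-x : ∀ x → x ⊑ cl x
  x⊑cl-x x = A∈V (x̂ ·T clT x̂) x̂ (λ P _ → ComplexAlgebra.cl-extensive P) (env₃ x x x)

  cl-height≤2 : ∀ x y → cl ((x ⊙ cl y) ⊙ (─ y)) ⊙ (─ x) ≡ 𝟘
  cl-height≤2 x y = A∈V (clT ((x̂ ·T clT ŷ) ·T negT ŷ) ·T negT x̂) zeroT
    (λ P P∈F → ComplexAlgebra.cl-height≤2 P (proj₁ P∈F)) (env₃ x y x)

  cl-𝟙 : cl 𝟙 ≡ 𝟙
  cl-𝟙 = trans (sym (⊙-identityˡ (cl 𝟙))) (x⊑cl-x 𝟙)

  cl-mono : ∀ {x y} → x ⊑ y → cl x ⊑ cl y
  cl-mono {x} {y} x⊑y = subst (cl x ⊑_) cl-y (x⊑x⊕y (cl x) (cl (y ⊙ (─ x))))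
    where
    cl-y : cl x ⊕ cl (y ⊙ (─ x)) ≡ cl y
    cl-y = begin
      cl x ⊕ cl (y ⊙ (─ x))        ≡⟨ cl-⊕ x (y ⊙ (─ x)) ⟨
      cl (x ⊕ (y ⊙ (─ x)))         ≡⟨ cong (λ u → cl (u ⊕ (y ⊙ (─ x)))) (trans (sym x⊑y) (⊙-comm x y)) ⟩
      cl ((y ⊙ x) ⊕ (y ⊙ (─ x)))   ≡⟨ cong cl (⊙-split y x) ⟩
      cl y                         ∎

  disjoint-below-cl⇒closed : ∀ {a b} → a ⊑ cl b → a ⊙ b ≡ 𝟘 → Closed A a
  disjoint-below-cl⇒closed {a} {b} a⊑cl-b a⊙b≡𝟘 = ⊑-antisym (x⊙─y≡𝟘⇒x⊑y cl-a⊙─a≡𝟘) (x⊑cl-x a)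
    where
    a-shape : (a ⊙ cl b) ⊙ (─ b) ≡ a
    a-shape = trans (cong (_⊙ (─ b)) a⊑cl-b) (x⊙y≡𝟘⇒x⊑─y a⊙b≡𝟘)
    cl-a⊙─a≡𝟘 : cl a ⊙ (─ a) ≡ 𝟘
    cl-a⊙─a≡𝟘 = subst (λ u → cl u ⊙ (─ a) ≡ 𝟘) a-shape (cl-height≤2 a b)

  atom-⊑-or-disjoint : ∀ {a} → Atom A a → ∀ b → a ⊙ b ≡ 𝟘 ⊎ a ⊑ b
  atom-⊑-or-disjoint {a} (_ , below-a) b = below-a (a ⊙ b) (x⊙y⊑x a b)

  atom-⊑? : ∀ {a} → Atom A a → ∀ b → Dec (a ⊑ b)
  atom-⊑? {a} at b with atom-⊑-or-disjoint at b
  ... | inj₁ a⊙b≡𝟘 = no λ a⊑b → proj₁ at (trans (sym a⊑b) a⊙b≡𝟘)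
  ... | inj₂ a⊑b   = yes a⊑b

  atom-⊑─⇔ : ∀ {a} → Atom A a → ∀ b → a ⊑ ─ b ⇔ (¬ a ⊑ b)
  atom-⊑─⇔ {a} at b = mk⇔ (λ a⊑─b a⊑b → proj₁ at (x⊑y∧x⊑─y⇒x≡𝟘 a⊑b a⊑─b)) ⊑─
    where
    ⊑─ : ¬ a ⊑ b → a ⊑ ─ b
    ⊑─ a⋢b with atom-⊑-or-disjoint at b
    ... | inj₁ a⊙b≡𝟘 = x⊙y≡𝟘⇒x⊑─y a⊙b≡𝟘
    ... | inj₂ a⊑b   = ⊥-elim (a⋢b a⊑b)

  atom-⊑⊕⇔ : ∀ {a} → Atom A a → ∀ b c → a ⊑ b ⊕ c ⇔ (a ⊑ b ⊎ a ⊑ c)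
  atom-⊑⊕⇔ {a} at b c = mk⇔ ⊑⊕⇒ ⊑⊕⇐
    where
    ⊑⊕⇐ : a ⊑ b ⊎ a ⊑ c → a ⊑ b ⊕ c
    ⊑⊕⇐ (inj₁ a⊑b) = ⊑-trans a⊑b (x⊑x⊕y b c)
    ⊑⊕⇐ (inj₂ a⊑c) = ⊑-trans a⊑c (y⊑x⊕y b c)
    ⊑⊕⇒ : a ⊑ b ⊕ c → a ⊑ b ⊎ a ⊑ c
    ⊑⊕⇒ a⊑b⊕c with atom-⊑-or-disjoint at b | atom-⊑-or-disjoint at c
    ... | inj₂ a⊑b | _        = inj₁ a⊑b
    ... | inj₁ _   | inj₂ a⊑c = inj₂ a⊑c
    ... | inj₁ a⊙b≡𝟘 | inj₁ a⊙c≡𝟘 = ⊥-elim (proj₁ at (begin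
      a                    ≡⟨ a⊑b⊕c ⟨
      a ⊙ (b ⊕ c)          ≡⟨ ⊙-distribˡ-⊕ a b c ⟩
      (a ⊙ b) ⊕ (a ⊙ c)    ≡⟨ cong₂ _⊕_ a⊙b≡𝟘 a⊙c≡𝟘 ⟩
      𝟘 ⊕ 𝟘                ≡⟨ ⊕-identityˡ 𝟘 ⟩
      𝟘                    ∎))

  ⊑⊙⇔ : ∀ {a} b c → a ⊑ b ⊙ c ⇔ (a ⊑ b × a ⊑ c)
  ⊑⊙⇔ b c = mk⇔ (λ a⊑b⊙c → ⊑-trans a⊑b⊙c (x⊙y⊑x b c) , ⊑-trans a⊑b⊙c (x⊙y⊑y b c))
                (λ (a⊑b , a⊑c) → ⊑-⊙ a⊑b a⊑c)

  Maximal : Carrier → Set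
  Maximal a = ∀ b → a ⊑ cl b → a ⊑ b

  nonclosed-atom-maximal : ∀ {a} → Atom A a → ¬ Closed A a → Maximal a
  nonclosed-atom-maximal at nonclosed b a⊑cl-b with atom-⊑-or-disjoint at b
  ... | inj₁ a⊙b≡𝟘 = ⊥-elim (nonclosed (disjoint-below-cl⇒closed a⊑cl-b a⊙b≡𝟘))
  ... | inj₂ a⊑b   = a⊑b

  -- b ↦ [a ⊑ b] is an ultrafilter; maximality of a makes it commute with cl.
  maximal-atom-Hom𝟚 : ∀ {a} → Atom A a → Maximal a → Hom A 𝟚
  maximal-atom-Hom𝟚 {a} at maximal = record
    { map    = λ b → does (a⊑? b)
    ; pres-𝟘 = dec-false (a⊑? 𝟘) (proj₁ at ∘ x⊑𝟘⇒x≡𝟘)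
    ; pres-𝟙 = dec-true (a⊑? 𝟙) (x⊑𝟙 a)
    ; pres-⊕ = λ b c → does-⇔ (atom-⊑⊕⇔ at b c) (a⊑? (b ⊕ c)) (a⊑? b ⊎-dec a⊑? c)
    ; pres-⊙ = λ b c → does-⇔ (⊑⊙⇔ b c) (a⊑? (b ⊙ c)) (a⊑? b ×-dec a⊑? c)
    ; pres-─ = λ b → does-⇔ (atom-⊑─⇔ at b) (a⊑? (─ b)) (¬? (a⊑? b))
    ; pres-cl = λ b → does-⇔ (mk⇔ (maximal b) (λ a⊑b → ⊑-trans a⊑b (x⊑cl-x b))) (a⊑? (cl b)) (a⊑? b)
    }
    where
    a⊑? : ∀ b → Dec (a ⊑ b)
    a⊑? = atom-⊑? at

  maximal-atom-Hom𝟚-self : ∀ {a} (at : Atom A a) (maximal : Maximal a) →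
    map (maximal-atom-Hom𝟚 at maximal) a ≡ true
  maximal-atom-Hom𝟚-self at maximal = dec-true (atom-⊑? at _) ⊑-refl

module FiniteInVariety {m : ℕ} (A : Alg) (A∈V : InV m A) (fin : Finite A) where
  open InVariety A A∈V

  private
    n : ℕ
    n = proj₁ fin
    to : Carrier → Fin n
    to = Inverse.to (proj₂ fin)
    from : Fin n → Carrier
    from = Inverse.from (proj₂ fin)
    from-to : ∀ x → from (to x) ≡ x
    from-to = Inverse.strictlyInverseʳ (proj₂ fin)

  _≟_ : (x y : Carrier) → Dec (x ≡ y)
  x ≟ y = map′ (λ e → trans (sym (from-to x)) (trans (cong from e) (from-to y))) (cong to) (to x ≟ᶠ to y)

  ∃? : {Q : Carrier → Set} → (∀ x → Dec (Q x)) → Dec (∃ Q)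
  ∃? {Q} Q? =
    map′ (λ (i , q) → from i , q) (λ (x , q) → to x , subst Q (sym (from-to x)) q) (any? (Q? ∘ from))

  _⊑?_ : ∀ x y → Dec (x ⊑ y)
  x ⊑? y = (x ⊙ y) ≟ x

  _⊏_ : Carrier → Carrier → Set
  x ⊏ y = x ⊑ y × x ≢ y

  below : Carrier → Subset n
  below c = tabulate (λ i → does (from i ⊑? c))

  ∈-below⁻ : ∀ {c i} → i ∈ below c → from i ⊑ c
  ∈-below⁻ {c} {i} i∈ = does≡true⇒ (from i ⊑? c) (trans (sym (lookup∘tabulate _ i)) ([]=⇒lookup i∈))

  ∈-below⁺ : ∀ {c i} → from i ⊑ c → i ∈ below c
  ∈-below⁺ {c} {i} i⊑c = lookup⇒[]= i (below c) (trans (lookup∘tabulate _ i) (dec-true (from i ⊑? c) i⊑c))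

  ⊏⇒below⊂ : ∀ {x y} → x ⊏ y → below x S.⊂ below y
  ⊏⇒below⊂ {x} {y} (x⊑y , x≢y) =
    (λ i∈ → ∈-below⁺ (⊑-trans (∈-below⁻ i∈) x⊑y)) ,
    to y , ∈-below⁺ (subst (_⊑ y) (sym (from-to y)) ⊑-refl) ,
    λ y∈ → x≢y (⊑-antisym x⊑y (subst (_⊑ x) (from-to y) (∈-below⁻ y∈)))

  ⊏-wellFounded : WellFounded _⊏_
  ⊏-wellFounded =
    Subrelation.wellFounded (p⊂q⇒∣p∣<∣q∣ ∘ ⊏⇒below⊂) (On.wellFounded (∣_∣ ∘ below) <-wellFounded)

  Minimal : (Carrier → Set) → Carrier → Set
  Minimal Q c = Q c × (∀ d → Q d → d ⊑ c → d ≡ c)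

  minimal : {Q : Carrier → Set} → (∀ x → Dec (Q x)) → ∀ {c} → Q c → ∃ (Minimal Q)
  minimal {Q} Q? {c} = go (⊏-wellFounded c)
    where
    go : ∀ {c} → Acc _⊏_ c → Q c → ∃ (Minimal Q)
    go {c} (acc smaller) qc with ∃? (λ d → Q? d ×-dec ((d ⊑? c) ×-dec ¬? (d ≟ c)))
    ... | yes (d , qd , d⊏c) = go (smaller d⊏c) qd
    ... | no ∄ = c , qc , λ d qd d⊑c → decidable-stable (d ≟ c) (λ d≢c → ∄ (d , qd , d⊑c , d≢c))

  atom-below : ∀ {x} → x ≢ 𝟘 → ∃ λ a → Atom A a × a ⊑ x
  atom-below {x} x≢𝟘 with minimal (λ c → ¬? (c ≟ 𝟘) ×-dec (c ⊑? x)) (x≢𝟘 , ⊑-refl)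
  ... | a , (a≢𝟘 , a⊑x) , least = a , (a≢𝟘 , atomic) , a⊑x
    where
    atomic : ∀ b → b ⊑ a → b ≡ 𝟘 ⊎ b ≡ a
    atomic b b⊑a with b ≟ 𝟘
    ... | yes b≡𝟘 = inj₁ b≡𝟘
    ... | no b≢𝟘  = inj₂ (least b (b≢𝟘 , ⊑-trans b⊑a a⊑x) b⊑a)

  minimal-cover-atom : ∀ {a b c} → Atom A a → Minimal (λ c → a ⊑ cl c × c ⊑ b) c → Atom A c
  minimal-cover-atom {a} {b} {c} at ((a⊑cl-c , c⊑b) , least) = c≢𝟘 , atomic
    where
    c≢𝟘 : c ≢ 𝟘
    c≢𝟘 refl = proj₁ at (x⊑𝟘⇒x≡𝟘 (subst (a ⊑_) cl-𝟘 a⊑cl-c))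
    atomic : ∀ d → d ⊑ c → d ≡ 𝟘 ⊎ d ≡ c
    atomic d d⊑c with Equivalence.to (atom-⊑⊕⇔ at (cl d) (cl (c ⊙ (─ d)))) (subst (a ⊑_) cl-c≡ a⊑cl-c)
      where
      cl-c≡ : cl c ≡ cl d ⊕ cl (c ⊙ (─ d))
      cl-c≡ = begin
        cl c                        ≡⟨ cong cl (⊙-split c d) ⟨
        cl ((c ⊙ d) ⊕ (c ⊙ (─ d)))  ≡⟨ cl-⊕ (c ⊙ d) (c ⊙ (─ d)) ⟩
        cl (c ⊙ d) ⊕ cl (c ⊙ (─ d)) ≡⟨ cong (λ u → cl u ⊕ cl (c ⊙ (─ d))) (trans (⊙-comm c d) d⊑c) ⟩
        cl d ⊕ cl (c ⊙ (─ d))       ∎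
    ... | inj₁ a⊑cl-d = inj₂ (least d (a⊑cl-d , ⊑-trans d⊑c c⊑b) d⊑c)
    ... | inj₂ a⊑cl-c⊙─d = inj₁ (x⊑y∧x⊑─y⇒x≡𝟘 ⊑-refl (⊑-trans d⊑c (subst (_⊑ ─ d) c⊙─d≡c (x⊙y⊑y c (─ d)))))
      where
      c⊙─d≡c : c ⊙ (─ d) ≡ c
      c⊙─d≡c = least (c ⊙ (─ d)) (a⊑cl-c⊙─d , ⊑-trans (x⊙y⊑x c (─ d)) c⊑b) (x⊙y⊑x c (─ d))

  maximal-atom-above : ∀ {a} → Atom A a → ∃ λ a′ → Atom A a′ × Maximal a′ × a ⊑ cl a′
  maximal-atom-above {a} at with ∃? (λ b → (a ⊑? cl b) ×-dec ((a ⊙ b) ≟ 𝟘))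
  ... | no ∄ = a , at , maximal , x⊑cl-x a
    where
    maximal : Maximal a
    maximal b a⊑cl-b with atom-⊑-or-disjoint at b
    ... | inj₁ a⊙b≡𝟘 = ⊥-elim (∄ (b , a⊑cl-b , a⊙b≡𝟘))
    ... | inj₂ a⊑b   = a⊑b
  ... | yes (b , a⊑cl-b , a⊙b≡𝟘) with minimal (λ c → (a ⊑? cl c) ×-dec (c ⊑? b)) (a⊑cl-b , ⊑-refl)
  ...   | c , c-minimal@((a⊑cl-c , c⊑b) , _) =
    c , c-atom , nonclosed-atom-maximal c-atom nonclosed , a⊑cl-c
    where
    c-atom = minimal-cover-atom at c-minimal
    nonclosed : ¬ Closed A c
    nonclosed cl-c≡c = proj₁ at (trans (sym (⊑-trans (subst (a ⊑_) cl-c≡c a⊑cl-c) c⊑b)) a⊙b≡𝟘)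

  maximal-atom-under-clopen : ∀ {e} → Closed A e → Closed A (─ e) → e ≢ 𝟘 →
    ∃ λ a → Atom A a × Maximal a × cl a ⊑ e
  maximal-atom-under-clopen {e} e-closed ─e-closed e≢𝟘 with atom-below e≢𝟘
  ... | a₀ , at₀ , a₀⊑e with maximal-atom-above at₀
  ... | a , at , maximal , a₀⊑cl-a = a , at , maximal , subst (cl a ⊑_) e-closed (cl-mono a⊑e)
    where
    a⊑e : a ⊑ e
    a⊑e with atom-⊑-or-disjoint at e
    ... | inj₂ a⊑e = a⊑e
    ... | inj₁ a⊙e≡𝟘 = ⊥-elim (proj₁ at₀ (x⊑y∧x⊑─y⇒x≡𝟘 a₀⊑e
            (⊑-trans a₀⊑cl-a (subst (cl a ⊑_) ─e-closed (cl-mono (x⊙y≡𝟘⇒x⊑─y a⊙e≡𝟘))))))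

  nontrivial-clopen⇒maximal-atoms : ∀ {e} → Closed A e → Closed A (─ e) → e ≢ 𝟘 → ─ e ≢ 𝟘 →
    Σ (Fin 2 → Carrier) λ a → (∀ i → Atom A (a i)) × (∀ i → Maximal (a i)) × prod A 2 (cl ∘ a) ≡ 𝟘
  nontrivial-clopen⇒maximal-atoms {e} e-closed ─e-closed e≢𝟘 ─e≢𝟘 =
    let a₁ , atom₁ , maximal₁ , cl-a₁⊑e = maximal-atom-under-clopen e-closed ─e-closed e≢𝟘
        a₂ , atom₂ , maximal₂ , cl-a₂⊑─e = maximal-atom-under-clopen ─e-closed ──e-closed ─e≢𝟘
    in (λ { fz → a₁ ; (fs _) → a₂ }) ,
       (λ { fz → atom₁ ; (fs _) → atom₂ }) ,
       (λ { fz → maximal₁ ; (fs _) → maximal₂ }) ,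
       trans (cong (cl a₁ ⊙_) (⊙-identityʳ (cl a₂))) (x⊑z∧y⊑─z⇒x⊙y≡𝟘 cl-a₁⊑e cl-a₂⊑─e)
    where
    ──e-closed : Closed A (─ (─ e))
    ──e-closed = subst (Closed A) (sym (─-involutive e)) e-closed

-- The fan and the one-point extension

module Fan (k : ℕ) where
  data _≼_ : Fin (suc k) → Fin (suc k) → Set where
    root≼ : ∀ {y} → fz ≼ y
    leaf≼ : ∀ {i} → fs i ≼ fs i

  ≼? : ∀ x y → Dec (x ≼ y)
  ≼? fz     y      = yes root≼
  ≼? (fs i) fz     = no λ ()
  ≼? (fs i) (fs j) with i ≟ᶠ j
  ... | yes refl = yes leaf≼
  ... | no i≢j   = no λ { leaf≼ → i≢j refl }

  ≼-refl : ∀ x → x ≼ x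
  ≼-refl fz     = root≼
  ≼-refl (fs i) = leaf≼

  ≼-antisym : ∀ {x y} → x ≼ y → y ≼ x → x ≡ y
  ≼-antisym root≼ root≼ = refl
  ≼-antisym leaf≼ _     = refl

  ≼-trans : ∀ {x y z} → x ≼ y → y ≼ z → x ≼ z
  ≼-trans root≼ _ = root≼
  ≼-trans leaf≼ q = q

  fan : FinPoset
  fan = record
    { size = suc k ; _≼_ = _≼_ ; ≼? = ≼? ; ≼-refl = ≼-refl ; ≼-antisym = ≼-antisym ; ≼-trans = ≼-trans }

  leaf-maximal : ∀ {i y} → fs i ≼ y → y ≡ fs i
  leaf-maximal leaf≼ = refl

  fan-height : HeightAtMost fan 2
  fan-height (b ∷ leaves) chain =
    ≤-trans (∣x∷p∣≤1+∣p∣ b leaves) (s≤s (∣p∣≤1 λ i∈ j∈ → same-leaf (chain _ _ (there i∈) (there j∈))))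
    where
    same-leaf : ∀ {i j} → fs i ≼ fs j ⊎ fs j ≼ fs i → i ≡ j
    same-leaf (inj₁ leaf≼) = refl
    same-leaf (inj₂ leaf≼) = refl

  fan-width : ∀ {m} → 1 ≤ m → k ≤ m → LocalWidthAtMost fan m
  fan-width 1≤m k≤m _ (inside ∷ leaves) _ antichain =
    ≤-trans (∣p∣≤1 λ x∈ y∈ → trans (sym (antichain fz _ here x∈ root≼)) (antichain fz _ here y∈ root≼)) 1≤m
  fan-width 1≤m k≤m _ (outside ∷ leaves) _ _ = ≤-trans (∣p∣≤n leaves) k≤m

  fan∈F : ∀ {m} → 1 ≤ m → k ≤ m → InF2 m fan
  fan∈F 1≤m k≤m = fan-height , fan-width 1≤m k≤m

module Extension {k : ℕ} (B : Alg) (φ : Fin k → Hom B 𝟚) where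
  open Alg B
  open Fan k
  private module F = Alg (Cm fan)

  leaves : Carrier → Vec Bool k
  leaves b = tabulate (λ i → map (φ i) b)

  embed : Carrier × Bool → Subset (suc k)
  embed (b , s) = s ∷ leaves b

  -- B with a new point below the points of the φ i: (b , s) stands for the subset s ∷ leaves b of the
  -- fan, and the closure of the new point is computed there.
  Ext : Alg
  Ext = record
    { Carrier = Carrier × Bool
    ; 𝟘       = 𝟘 , false
    ; 𝟙       = 𝟙 , true
    ; _⊕_     = λ (b , s) (c , t) → b ⊕ c , s ∨ t
    ; _⊙_     = λ (b , s) (c , t) → b ⊙ c , s ∧ t
    ; ─_      = λ (b , s) → ─ b , not s
    ; cl      = λ (b , s) → cl b , lookup (F.cl (embed (b , s))) fz
    }

  first : Hom Ext B
  first = record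
    { map = proj₁ ; pres-𝟘 = refl ; pres-𝟙 = refl ; pres-⊕ = λ _ _ → refl
    ; pres-⊙ = λ _ _ → refl ; pres-─ = λ _ → refl ; pres-cl = λ _ → refl }

  embedHom : Hom Ext (Cm fan)
  embedHom = record
    { map     = embed
    ; pres-𝟘  = cong (false ∷_) (trans (tabulate-cong (pres-𝟘 ∘ φ)) (tabulate-const false))
    ; pres-𝟙  = cong (true ∷_) (trans (tabulate-cong (pres-𝟙 ∘ φ)) (tabulate-const true))
    ; pres-⊕  = λ (b , s) (c , t) → cong ((s ∨ t) ∷_)
        (trans (tabulate-cong λ i → pres-⊕ (φ i) b c) (tabulate-zipWith _∨_ _ _))
    ; pres-⊙  = λ (b , s) (c , t) → cong ((s ∧ t) ∷_)
        (trans (tabulate-cong λ i → pres-⊙ (φ i) b c) (tabulate-zipWith _∧_ _ _))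
    ; pres-─  = λ (b , s) → cong (not s ∷_) (trans (tabulate-cong λ i → pres-─ (φ i) b) (tabulate-∘ not _))
    ; pres-cl = embed-cl
    }
    where
    leaf-cl : ∀ b s i → lookup (F.cl (embed (b , s))) (fs i) ≡ map (φ i) (cl b)
    leaf-cl b s i = begin
      lookup (F.cl (embed (b , s))) (fs i)
        ≡⟨ ComplexAlgebra.lookup-cl-maximal fan (embed (b , s)) leaf-maximal ⟩
      lookup (leaves b) i                   ≡⟨ lookup∘tabulate _ i ⟩
      map (φ i) b                           ≡⟨ pres-cl (φ i) b ⟨
      map (φ i) (cl b)                      ∎
    embed-cl : ∀ x → embed (Alg.cl Ext x) ≡ F.cl (embed x)
    embed-cl (b , s) = cong (lookup (F.cl (embed (b , s))) fz ∷_) (sym (tabulate-cong λ i →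
      trans (sym (ComplexAlgebra.lookup-cl fan (embed (b , s)) (fs i))) (leaf-cl b s i)))

  Ext∈V : ∀ {m} → InV m B → 1 ≤ m → k ≤ m → InV m Ext
  Ext∈V B∈V 1≤m k≤m = InV-jointEmbedding B∈V (InV-Cm {P = fan} (fan∈F 1≤m k≤m)) first embedHom
    λ b≡c embed≡ → cong₂ _,_ b≡c (cong head embed≡)

  new-point-below : ∀ x i → map (φ i) (proj₁ x) ≡ true → proj₂ (Alg.cl Ext x) ≡ true
  new-point-below (b , s) i φᵢb =
    []=⇒lookup (ComplexAlgebra.∈-cl⁺ fan {embed (b , s)} {fz} leaf∈ root≼)
    where
    leaf∈ : fs i ∈ embed (b , s)
    leaf∈ = lookup⇒[]= (fs i) (embed (b , s)) (trans (lookup∘tabulate _ i) φᵢb)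

  proj₂-prod≡true : ∀ n (xs : Fin n → Carrier × Bool) → (∀ i → proj₂ (xs i) ≡ true) →
    proj₂ (prod Ext n xs) ≡ true
  proj₂-prod≡true zero    xs all-true = refl
  proj₂-prod≡true (suc n) xs all-true = cong₂ _∧_ (all-true fz) (proj₂-prod≡true n (xs ∘ fs) (all-true ∘ fs))

projective⇒cl-prod≢𝟘 : ∀ {m k} (B : Alg) → InV m B → Projective m B → 1 ≤ m → k ≤ m →
  (φ : Fin k → Hom B 𝟚) (b : Fin k → Alg.Carrier B) → (∀ i → map (φ i) (b i) ≡ true) →
  prod B k (Alg.cl B ∘ b) ≢ Alg.𝟘 B
projective⇒cl-prod≢𝟘 {k = k} B B∈V B-projective 1≤m k≤m φ b φᵢbᵢ prod≡𝟘 = true≢false (begin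
  true                                  ≡⟨ proj₂-prod≡true k (map q ∘ cl ∘ b) q-cl-bᵢ ⟨
  proj₂ (prod Ext k (map q ∘ cl ∘ b))   ≡⟨ cong proj₂ (map-prod q k (cl ∘ b)) ⟨
  proj₂ (map q (prod B k (cl ∘ b)))     ≡⟨ cong (proj₂ ∘ map q) prod≡𝟘 ⟩
  proj₂ (map q 𝟘)                       ≡⟨ cong proj₂ (pres-𝟘 q) ⟩
  false                                 ∎)
  where
  open Alg B
  open Extension B φ

  section : Σ (Hom B Ext) λ q → ∀ c → proj₁ (map q c) ≡ c
  section = B-projective Ext (Ext∈V B∈V 1≤m k≤m) first (λ c → (c , false) , refl)

  q : Hom B Ext
  q = proj₁ section

  q-cl-bᵢ : ∀ i → proj₂ (map q (cl (b i))) ≡ true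
  q-cl-bᵢ i = trans (cong proj₂ (pres-cl q (b i)))
    (new-point-below (map q (b i)) i (trans (cong (map (φ i)) (proj₂ section (b i))) (φᵢbᵢ i)))

  true≢false : true ≢ false
  true≢false ()

projective⇒maximal-atoms-cl-prod≢𝟘 : ∀ {m k} (B : Alg) (B∈V : InV m B) → Projective m B → 1 ≤ m → k ≤ m →
  (a : Fin k → Alg.Carrier B) (atoms : ∀ i → Atom B (a i)) → (∀ i → InVariety.Maximal B B∈V (a i)) →
  prod B k (Alg.cl B ∘ a) ≢ Alg.𝟘 B
projective⇒maximal-atoms-cl-prod≢𝟘 B B∈V B-projective 1≤m k≤m a atoms maximal =
  projective⇒cl-prod≢𝟘 B B∈V B-projective 1≤m k≤m
    (λ i → maximal-atom-Hom𝟚 (atoms i) (maximal i)) a (λ i → maximal-atom-Hom𝟚-self (atoms i) (maximal i))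
  where open InVariety B B∈V

-- Direct decompositions

module Decomposition {m : ℕ} {B C D : Alg} (B∈V : InV m B) (iso : Isomorphic B (C ⊗ D)) where
  open Alg B
  private
    module C = Alg C
    module D = Alg D

  h : Hom B (C ⊗ D)
  h = proj₁ iso

  g : C.Carrier × D.Carrier → Carrier
  g = proj₁ (proj₂ iso)

  g∘h : ∀ x → g (map h x) ≡ x
  g∘h = proj₁ (proj₂ (proj₂ iso))

  h∘g : ∀ y → map h (g y) ≡ y
  h∘g = proj₂ (proj₂ (proj₂ iso))

  module CD = InVariety (C ⊗ D) (InV-image B∈V h λ y → g y , h∘g y)

  h-injective : ∀ {x y} → map h x ≡ map h y → x ≡ y
  h-injective {x} {y} hx≡hy = trans (sym (g∘h x)) (trans (cong g hx≡hy) (g∘h y))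

  closed-via-h : ∀ {x c d} → map h x ≡ (c , d) → C.cl c ≡ c → D.cl d ≡ d → Closed B x
  closed-via-h {x} {c} {d} hx≡ cl-c cl-d = h-injective (begin
    map h (cl x)        ≡⟨ pres-cl h x ⟩
    CD.cl (map h x)     ≡⟨ cong CD.cl hx≡ ⟩
    (C.cl c , D.cl d)   ≡⟨ cong₂ _,_ cl-c cl-d ⟩
    (c , d)             ≡⟨ hx≡ ⟨
    map h x             ∎)

  C-trivial : C.𝟙 ≡ C.𝟘 → D.Carrier → ∀ c → c ≡ C.𝟘
  C-trivial 𝟙≡𝟘 d c = begin
    c               ≡⟨ cong proj₁ (CD.⊙-identityʳ (c , d)) ⟨
    c C.⊙ C.𝟙       ≡⟨ cong (c C.⊙_) 𝟙≡𝟘 ⟩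
    c C.⊙ C.𝟘       ≡⟨ cong proj₁ (CD.⊙-zeroʳ (c , d)) ⟩
    C.𝟘             ∎

  D-trivial : D.𝟙 ≡ D.𝟘 → C.Carrier → ∀ d → d ≡ D.𝟘
  D-trivial 𝟙≡𝟘 c d = begin
    d               ≡⟨ cong proj₂ (CD.⊙-identityʳ (c , d)) ⟨
    d D.⊙ D.𝟙       ≡⟨ cong (d D.⊙_) 𝟙≡𝟘 ⟩
    d D.⊙ D.𝟘       ≡⟨ cong proj₂ (CD.⊙-zeroʳ (c , d)) ⟩
    D.𝟘             ∎

  e : Carrier
  e = g (C.𝟙 , D.𝟘)

  h-e : map h e ≡ (C.𝟙 , D.𝟘)
  h-e = h∘g _

  h-─e : map h (─ e) ≡ (C.𝟘 , D.𝟙)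
  h-─e = trans (pres-─ h e) (trans (cong CD.─_ h-e) (cong₂ _,_ (cong proj₁ CD.─𝟙) (cong proj₂ CD.─𝟘)))

decomposable⇒nontrivial-clopen : ∀ {m B C D} → InV m B → Nontrivial C → Nontrivial D →
  Isomorphic B (C ⊗ D) →
  ∃ λ e → Closed B e × Closed B (Alg.─_ B e) × e ≢ Alg.𝟘 B × Alg.─_ B e ≢ Alg.𝟘 B
decomposable⇒nontrivial-clopen B∈V (c₁ , c₂ , c₁≢c₂) (d₁ , d₂ , d₁≢d₂) iso =
  e ,
  closed-via-h h-e (cong proj₁ CD.cl-𝟙) (cong proj₂ CD.cl-𝟘) ,
  closed-via-h h-─e (cong proj₁ CD.cl-𝟘) (cong proj₂ CD.cl-𝟙) ,
  (λ e≡𝟘 → let 𝟙≡𝟘 = cong proj₁ (trans (sym h-e) (trans (cong (map h) e≡𝟘) (pres-𝟘 h))) in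
    c₁≢c₂ (trans (C-trivial 𝟙≡𝟘 d₁ c₁) (sym (C-trivial 𝟙≡𝟘 d₁ c₂)))) ,
  (λ ─e≡𝟘 → let 𝟙≡𝟘 = cong proj₂ (trans (sym h-─e) (trans (cong (map h) ─e≡𝟘) (pres-𝟘 h))) in
    d₁≢d₂ (trans (D-trivial 𝟙≡𝟘 c₁ d₁) (sym (D-trivial 𝟙≡𝟘 c₁ d₂))))
  where
  open Decomposition B∈V iso

mainTheorem6 : (m : ℕ) → 2 ≤ m → (B : Alg) → InV m B → Finite B → Projective m B →
    DirectlyIndecomposable B ×
    (∀ (k : ℕ) → 1 ≤ k → k ≤ m → (a : Fin k → Alg.Carrier B) →
      (∀ i → Atom B (a i)) → (∀ i → ¬ Closed B (a i)) →
      prod B k (λ i → Alg.cl B (a i)) ≢ Alg.𝟘 B)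
mainTheorem6 m 2≤m B B∈V B-finite B-projective = indecomposable , nonclosed-atoms-cl-prod≢𝟘
  where
  open InVariety B B∈V
  open FiniteInVariety B B∈V B-finite

  1≤m : 1 ≤ m
  1≤m = ≤-trans (s≤s z≤n) 2≤m

  nonclosed-atoms-cl-prod≢𝟘 : ∀ k → 1 ≤ k → k ≤ m → (a : Fin k → Carrier) →
    (∀ i → Atom B (a i)) → (∀ i → ¬ Closed B (a i)) → prod B k (cl ∘ a) ≢ 𝟘
  nonclosed-atoms-cl-prod≢𝟘 k _ k≤m a atoms nonclosed =
    projective⇒maximal-atoms-cl-prod≢𝟘 B B∈V B-projective 1≤m k≤m a atoms
      (λ i → nonclosed-atom-maximal (atoms i) (nonclosed i))

  indecomposable : DirectlyIndecomposable B
  indecomposable (C , D , C-nontrivial , D-nontrivial , iso) =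
    let _ , e-closed , ─e-closed , e≢𝟘 , ─e≢𝟘 =
          decomposable⇒nontrivial-clopen B∈V C-nontrivial D-nontrivial iso
        a , atoms , maximal , cl-prod≡𝟘 = nontrivial-clopen⇒maximal-atoms e-closed ─e-closed e≢𝟘 ─e≢𝟘
    in projective⇒maximal-atoms-cl-prod≢𝟘 B B∈V B-projective 1≤m 2≤m a atoms maximal cl-prod≡𝟘
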